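{- Let $n\ge 0$, let $P_{n+1}$ be the path with vertices $v_0,\dots,v_n$ and edges $v_iv_{i+1}$ ($0\le i\le n-1$), let $w:\{v_0,\dots,v_n\}\to\mathbb{N}$ be a weight function, and let $L$ be a list assignment of $P_{n+1}$ (each $L(i)=L(v_i)$ a finite subset of $\mathbb{N}$) which is good, i.e. $|L(i)|\ge w(i)+w(i+1)$ for every $i$ with $1\le i\le n-1$. Then there exists a waterfall list $L^c$ of $P_{n+1}$ which is similar to $L$ and satisfies $|L^c(i)|=|L(i)|$ for all $i\in\{0,\dots,n\}$.
   Context: An $(L,w)$-coloring of a graph $G$ with list assignment $L$ and weight function $w$ is a map $c$ assigning to each vertex $v$ a set $c(v)\subseteq L(v)$ with $|c(v)|=w(v)$ such that $c(v)\cap c(v')=\emptyset$ for every edge $vv'$; $G$ is $(L,w)$-colorable if such a $c$ exists. Two lists $L,L'$ are similar (with respect to the weighted graph $(G,w)$) if $G$ is $(L,w)$-colorable if and only if $G$ is $(L',w)$-colorable. A list $L$ of $P_{n+1}$ is a waterfall list if $L(i)\cap L(j)=\emptyset$ for all $i,j\in\{0,\dots,n\}$ with $|i-j|\ge 2$. Notation: $L(i)$ and $w(i)$ stand for $L(v_i)$ and $w(v_i)$. -}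

module Defs where

open import Data.Nat using (ℕ; suc; _+_; _≤_; _<_)
open import Data.Fin using (Fin; toℕ)
open import Data.List using (List; length)
open import Data.List.Membership.Propositional using (_∈_; _∉_)
open import Data.List.Relation.Unary.Unique.Propositional using (Unique)
open import Data.List.Relation.Binary.Subset.Propositional using (_⊆_)
open import Data.Product using (Σ; _×_)
open import Data.Sum using (_⊎_)
open import Relation.Binary.PropositionalEquality using (_≡_)
open import Function.Bundles using (_⇔_)

-- A finite subset of ℕ is represented by a duplicate-free list; its
-- cardinality is the length of the list.

Edge : {n : ℕ} → Fin (suc n) → Fin (suc n) → Set
Edge i j = toℕ j ≡ suc (toℕ i)

Disjoint : List ℕ → List ℕ → Set
Disjoint A B = ∀ {x} → x ∈ A → x ∉ B

ListAssignment : ℕ → Set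
ListAssignment n = Fin (suc n) → List ℕ

IsListAssignment : {n : ℕ} → ListAssignment n → Set
IsListAssignment L = ∀ i → Unique (L i)

Weight : ℕ → Set
Weight n = Fin (suc n) → ℕ

IsColoring : {n : ℕ} → ListAssignment n → Weight n → (Fin (suc n) → List ℕ) → Set
IsColoring L w c =
  (∀ i → Unique (c i)) ×
  (∀ i → c i ⊆ L i) ×
  (∀ i → length (c i) ≡ w i) ×
  (∀ i j → Edge i j → Disjoint (c i) (c j))

Colorable : {n : ℕ} → ListAssignment n → Weight n → Set
Colorable {n} L w = Σ (Fin (suc n) → List ℕ) (IsColoring L w)

Similar : {n : ℕ} → Weight n → ListAssignment n → ListAssignment n → Set
Similar w L L′ = Colorable L w ⇔ Colorable L′ w

Waterfall : {n : ℕ} → ListAssignment n → Set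
Waterfall L = ∀ i j → (toℕ i + 2 ≤ toℕ j ⊎ toℕ j + 2 ≤ toℕ i) → Disjoint (L i) (L j)

Good : {n : ℕ} → Weight n → ListAssignment n → Set
Good {n} w L = ∀ i j → 1 ≤ toℕ i → suc (toℕ i) < suc n → Edge i j →
  w i + w j ≤ length (L i)

-- Charge every colour shared by L k and L (k+1) to one of the two edges at k, to the left
-- one whenever possible.  Colourability of the path then depends only on the weights, the
-- sizes |L k| and the numbers z k of colours charged to the edges: reading the path from its
-- right end, a colouring must use at vertex k at least a computable number of colours charged
-- to the edge on its left (its demand), and the greedy colouring that avoids these colours as
-- long as it can attains all the bounds; goodness makes sure it never runs out of colours at
-- the inner vertices.  The waterfall list realises the same numbers with consecutive intervals
-- of ℕ, L k and L (k+1) overlapping in exactly z (k+1) colours.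

module Submission where

open import Defs
open import Data.Nat using (ℕ; zero; suc; _+_; _∸_; _≤_; _<_; z≤n; s≤s; _≟_)
open import Data.Nat.Properties
open import Data.Fin using (Fin; toℕ; fromℕ<)
import Data.Fin.Properties as Fin
open import Data.List using (List; []; _∷_; length; _++_; filter; take; applyUpTo)
open import Data.List.Properties
  using (length-++; length-filter; length-take; length-applyUpTo; filter-notAll)
open import Data.List.Membership.Propositional using (_∈_; _∉_)
open import Data.List.Membership.Propositional.Properties
  using (∈-filter⁺; ∈-filter⁻; ∈-++⁺ˡ; ∈-++⁺ʳ; ∈-++⁻; ∈-applyUpTo⁺; ∈-applyUpTo⁻)
open import Data.List.Membership.DecPropositional _≟_ using (_∈?_)
open import Data.List.Relation.Unary.Any using (here; there)
import Data.List.Relation.Unary.Any as Any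
import Data.List.Relation.Unary.All as All
open import Data.List.Relation.Unary.AllPairs using (_∷_)
open import Data.List.Relation.Unary.Unique.Propositional using (Unique)
import Data.List.Relation.Unary.Unique.Propositional.Properties as Unique
open import Data.List.Relation.Binary.Subset.Propositional using (_⊆_)
open import Data.Product using (Σ; _×_; _,_; proj₁; proj₂)
open import Data.Sum using (_⊎_; inj₁; inj₂; [_,_]′)
open import Function using (_∘_)
open import Function.Bundles using (_⇔_; mk⇔)
import Function.Properties.Equivalence as ⇔
open import Relation.Nullary using (¬?; yes; no; contradiction)
open import Relation.Binary.PropositionalEquality

infixl 7 _∩_
infixl 6 _∖_

_∩_ : List ℕ → List ℕ → List ℕ
xs ∩ ys = filter (_∈? ys) xs

_∖_ : List ℕ → List ℕ → List ℕ
xs ∖ ys = filter (λ x → ¬? (x ∈? ys)) xs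

module _ {x : ℕ} (xs ys : List ℕ) where

  ∈-∩⁻ : x ∈ xs ∩ ys → x ∈ xs × x ∈ ys
  ∈-∩⁻ = ∈-filter⁻ (_∈? ys)

  ∈-∖⁻ : x ∈ xs ∖ ys → x ∈ xs × x ∉ ys
  ∈-∖⁻ = ∈-filter⁻ (λ y → ¬? (y ∈? ys))

module _ {x : ℕ} {xs ys : List ℕ} where

  ∈-∩⁺ : x ∈ xs → x ∈ ys → x ∈ xs ∩ ys
  ∈-∩⁺ = ∈-filter⁺ (_∈? ys)

  ∈-∖⁺ : x ∈ xs → x ∉ ys → x ∈ xs ∖ ys
  ∈-∖⁺ = ∈-filter⁺ (λ y → ¬? (y ∈? ys))

module _ {xs : List ℕ} (ys : List ℕ) where

  ∩-unique : Unique xs → Unique (xs ∩ ys)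
  ∩-unique = Unique.filter⁺ (_∈? ys)

  ∖-unique : Unique xs → Unique (xs ∖ ys)
  ∖-unique = Unique.filter⁺ (λ y → ¬? (y ∈? ys))

length-∩+∖ : ∀ xs ys → length (xs ∩ ys) + length (xs ∖ ys) ≡ length xs
length-∩+∖ []       ys = refl
length-∩+∖ (x ∷ xs) ys with x ∈? ys
... | yes _ = cong suc (length-∩+∖ xs ys)
... | no  _ = trans (+-suc _ _) (cong suc (length-∩+∖ xs ys))

Unique⇒length-≤ : ∀ {xs ys : List ℕ} → Unique xs → xs ⊆ ys → length xs ≤ length ys
Unique⇒length-≤ {[]}     _           _     = z≤n
Unique⇒length-≤ {x ∷ xs} {ys} (x∉xs ∷ u) x∷xs⊆ys =
  ≤-trans (s≤s (Unique⇒length-≤ u xs⊆ys-x)) (filter-notAll ≢x? ys x∈ys)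
  where
  ≢x? = λ y → ¬? (y ≟ x)
  xs⊆ys-x : xs ⊆ filter ≢x? ys
  xs⊆ys-x y∈xs =
    ∈-filter⁺ ≢x? (x∷xs⊆ys (there y∈xs)) (λ y≡x → All.lookup x∉xs y∈xs (sym y≡x))
  x∈ys = Any.map (λ y≡x y≢x → y≢x (sym y≡x)) (x∷xs⊆ys (here refl))

length-∩-≤ : ∀ {xs} ys → Unique xs → length (xs ∩ ys) ≤ length ys
length-∩-≤ {xs} ys u = Unique⇒length-≤ (∩-unique ys u) (proj₂ ∘ ∈-∩⁻ xs ys)

++-unique : ∀ {xs ys : List ℕ} → Unique xs → Unique ys → Disjoint xs ys → Unique (xs ++ ys)
++-unique uxs uys xs#ys = Unique.++⁺ uxs uys (λ (x∈xs , x∈ys) → xs#ys x∈xs x∈ys)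

++-⊆ : ∀ {xs ys zs : List ℕ} → xs ⊆ zs → ys ⊆ zs → xs ++ ys ⊆ zs
++-⊆ {xs} xs⊆zs ys⊆zs x∈ = [ xs⊆zs , ys⊆zs ]′ (∈-++⁻ xs x∈)

length-disjoint-≤ : ∀ {xs ys zs : List ℕ} → Unique xs → Unique ys → Disjoint xs ys →
  xs ⊆ zs → ys ⊆ zs → length xs + length ys ≤ length zs
length-disjoint-≤ {xs} uxs uys xs#ys xs⊆zs ys⊆zs =
  subst (_≤ _) (length-++ xs) (Unique⇒length-≤ (++-unique uxs uys xs#ys) (++-⊆ xs⊆zs ys⊆zs))

length-disjoint₃-≤ : ∀ {xs ys zs vs : List ℕ} → Unique xs → Unique ys → Unique zs →
  Disjoint xs ys → Disjoint xs zs → Disjoint ys zs →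
  xs ⊆ vs → ys ⊆ vs → zs ⊆ vs → length xs + length ys + length zs ≤ length vs
length-disjoint₃-≤ {xs} {ys} uxs uys uzs xs#ys xs#zs ys#zs xs⊆ ys⊆ zs⊆ =
  subst (λ l → l + _ ≤ _) (length-++ xs)
    (length-disjoint-≤ (++-unique uxs uys xs#ys) uzs
      (λ x∈ → [ xs#zs , ys#zs ]′ (∈-++⁻ xs x∈)) (++-⊆ xs⊆ ys⊆) zs⊆)

∈-take : ∀ {x : ℕ} t xs → x ∈ take t xs → x ∈ xs
∈-take (suc t) (y ∷ xs) (here x≡y)  = here x≡y
∈-take (suc t) (y ∷ xs) (there x∈) = there (∈-take t xs x∈)

length-take-≡ : ∀ t (xs : List ℕ) → t ≤ length xs → length (take t xs) ≡ t
length-take-≡ t xs t≤ = trans (length-take t xs) (m≤n⇒m⊓n≡m t≤)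

length-take-++-∩ : ∀ t ys zs vs → Disjoint ys vs →
  length (take t (ys ++ zs) ∩ vs) ≤ t ∸ length ys
length-take-++-∩ zero    ys       zs vs ys#vs = z≤n
length-take-++-∩ (suc t) []       zs vs ys#vs =
  ≤-trans (length-filter (_∈? vs) (take (suc t) zs))
          (≤-trans (≤-reflexive (length-take (suc t) zs)) (m⊓n≤m (suc t) _))
length-take-++-∩ (suc t) (y ∷ ys) zs vs ys#vs with y ∈? vs
... | yes y∈vs = contradiction y∈vs (ys#vs (here refl))
... | no  _    = length-take-++-∩ t ys zs vs (ys#vs ∘ there)

takeAvoiding : ℕ → List ℕ → List ℕ → List ℕ
takeAvoiding t zs xs = take t (xs ∖ zs ++ xs ∩ zs)

module _ (t : ℕ) (zs xs : List ℕ) where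

  takeAvoiding-⊆ : takeAvoiding t zs xs ⊆ xs
  takeAvoiding-⊆ x∈ =
    [ proj₁ ∘ ∈-∖⁻ xs zs , proj₁ ∘ ∈-∩⁻ xs zs ]′ (∈-++⁻ (xs ∖ zs) (∈-take t _ x∈))

  takeAvoiding-unique : Unique xs → Unique (takeAvoiding t zs xs)
  takeAvoiding-unique u = Unique.take⁺ t (++-unique (∖-unique zs u) (∩-unique zs u)
    (λ x∈∖ x∈∩ → proj₂ (∈-∖⁻ xs zs x∈∖) (proj₂ (∈-∩⁻ xs zs x∈∩))))

  length-takeAvoiding : t ≤ length xs → length (takeAvoiding t zs xs) ≡ t
  length-takeAvoiding t≤ = length-take-≡ t _ (subst (t ≤_) length-xs t≤)
    where
    length-xs : length xs ≡ length (xs ∖ zs ++ xs ∩ zs)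
    length-xs = begin
      length xs                                 ≡⟨ sym (length-∩+∖ xs zs) ⟩
      length (xs ∩ zs) + length (xs ∖ zs)       ≡⟨ +-comm (length (xs ∩ zs)) _ ⟩
      length (xs ∖ zs) + length (xs ∩ zs)       ≡⟨ sym (length-++ (xs ∖ zs)) ⟩
      length (xs ∖ zs ++ xs ∩ zs)               ∎
      where open ≡-Reasoning

  length-takeAvoiding-∩ : length (takeAvoiding t zs xs ∩ zs) ≤ t ∸ length (xs ∖ zs)
  length-takeAvoiding-∩ = length-take-++-∩ t (xs ∖ zs) (xs ∩ zs) zs (proj₂ ∘ ∈-∖⁻ xs zs)

interval : ℕ → ℕ → List ℕ
interval a l = applyUpTo (a +_) l

module _ {a l x : ℕ} where

  ∈-interval⁻ : x ∈ interval a l → a ≤ x × x < a + l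
  ∈-interval⁻ x∈ with ∈-applyUpTo⁻ (a +_) x∈
  ... | i , i<l , refl = m≤m+n a i , +-monoʳ-< a i<l

  ∈-interval⁺ : a ≤ x → x < a + l → x ∈ interval a l
  ∈-interval⁺ a≤x x<a+l = subst (_∈ interval a l) (m+[n∸m]≡n a≤x)
    (∈-applyUpTo⁺ (a +_)
      (+-cancelˡ-< a (x ∸ a) l (subst (_< a + l) (sym (m+[n∸m]≡n a≤x)) x<a+l)))

interval-unique : ∀ a l → Unique (interval a l)
interval-unique a l = Unique.applyUpTo⁺₁ (a +_) l (λ i<j _ → <⇒≢ i<j ∘ +-cancelˡ-≡ a _ _)

length-interval : ∀ a l → length (interval a l) ≡ l
length-interval a l = length-applyUpTo (a +_) l

interval-⊆ : ∀ {a l a′ l′} → a ≤ a′ → a′ + l′ ≤ a + l → interval a′ l′ ⊆ interval a l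
interval-⊆ a≤a′ end≤ x∈ = let (a′≤x , x<end) = ∈-interval⁻ x∈ in
  ∈-interval⁺ (≤-trans a≤a′ a′≤x) (<-≤-trans x<end end≤)

interval-disjoint : ∀ {a l a′ l′} → a + l ≤ a′ → Disjoint (interval a l) (interval a′ l′)
interval-disjoint end≤a′ x∈ x∈′ =
  <⇒≱ (<-≤-trans (proj₂ (∈-interval⁻ x∈)) end≤a′) (proj₁ (∈-interval⁻ x∈′))

-- Colourings of the path 0, …, N indexed by ℕ rather than Fin, so that recursion along the
-- path is structural; values beyond N are irrelevant.
record IsPathColoring (N : ℕ) (L : ℕ → List ℕ) (w : ℕ → ℕ) (c : ℕ → List ℕ) : Set where
  field
    unique   : ∀ k → k ≤ N → Unique (c k)
    ⊆-list   : ∀ k → k ≤ N → c k ⊆ L k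
    length-≡ : ∀ k → k ≤ N → length (c k) ≡ w k
    disjoint : ∀ k → k < N → Disjoint (c k) (c (suc k))

PathColorable : ℕ → (ℕ → List ℕ) → (ℕ → ℕ) → Set
PathColorable N L w = Σ (ℕ → List ℕ) (IsPathColoring N L w)

PathGood : ℕ → (ℕ → ℕ) → (ℕ → List ℕ) → Set
PathGood N w L = ∀ k → 1 ≤ k → k < N → w k + w (suc k) ≤ length (L k)

-- Z (k+1) ⊆ L k ∩ L (k+1) holds the colours charged to the edge k (k+1); every colour
-- common to L k and L (k+1) is charged to one of the two edges at k.
record EdgeSplitting (L Z : ℕ → List ℕ) : Set where
  field
    unique   : ∀ k → Unique (Z k)
    ⊆-here   : ∀ k → Z k ⊆ L k
    ⊆-pred   : ∀ k → Z (suc k) ⊆ L k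
    disjoint : ∀ k → Disjoint (Z k) (Z (suc k))
    covers   : ∀ k {x} → x ∈ L k → x ∈ L (suc k) → x ∈ Z k ⊎ x ∈ Z (suc k)
    empty    : Z 0 ≡ []

EdgeSplitting-fits : ∀ {L Z} → EdgeSplitting L Z →
  ∀ k → length (Z k) + length (Z (suc k)) ≤ length (L k)
EdgeSplitting-fits split k =
  length-disjoint-≤ (unique k) (unique (suc k)) (disjoint k) (⊆-here k) (⊆-pred k)
  where open EdgeSplitting split

-- demand w s z f k bounds from below how many colours of Z k a colouring of the
-- vertices k, …, k + f - 1 must use at k: whatever does not fit into the
-- s k - z k colours of L k outside Z k.
demand : (w s z : ℕ → ℕ) → ℕ → ℕ → ℕ
demand w s z zero    k = 0
demand w s z (suc f) k = (w k + demand w s z f (suc k)) ∸ (s k ∸ z k)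

demand-cong : ∀ {w s z s′ z′} → (∀ k → s k ≡ s′ k) → (∀ k → z k ≡ z′ k) →
  ∀ f k → demand w s z f k ≡ demand w s′ z′ f k
demand-cong         s≡ z≡ zero    k = refl
demand-cong {w = w} s≡ z≡ (suc f) k =
  cong₂ _∸_ (cong (w k +_) (demand-cong s≡ z≡ f (suc k))) (cong₂ _∸_ (s≡ k) (z≡ k))

-- Vertex 0 has no left edge (Z 0 is empty), so its demand has to vanish.
Feasible : ℕ → (w s z : ℕ → ℕ) → Set
Feasible N w s z = w N ≤ s N × demand w s z (suc N) 0 ≡ 0

Feasible-resp : ∀ {N w s z s′ z′} → (∀ k → s k ≡ s′ k) → (∀ k → z k ≡ z′ k) →
  Feasible N w s z → Feasible N w s′ z′
Feasible-resp {N} {w} s≡ z≡ (w≤s , demand≡0) =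
  subst (w N ≤_) (s≡ N) w≤s , trans (sym (demand-cong {w = w} s≡ z≡ (suc N) 0)) demand≡0

+-suc-≡ : ∀ {k f N} → k + suc f ≡ N → suc k + f ≡ N
+-suc-≡ {k} {f} eq = trans (sym (+-suc k f)) eq

module Characterisation {L Z : ℕ → List ℕ} (split : EdgeSplitting L Z) (N : ℕ) (w : ℕ → ℕ) where

  open EdgeSplitting split

  s z : ℕ → ℕ
  s k = length (L k)
  z k = length (Z k)

  module _ {c : ℕ → List ℕ} (coloring : IsPathColoring N L w c) where

    private
      module C = IsPathColoring coloring

    outside-≤ : ∀ k → k ≤ N → length (c k ∖ Z k) + z k ≤ s k
    outside-≤ k k≤N = length-disjoint-≤ (∖-unique (Z k) (C.unique k k≤N)) (unique k)
      (proj₂ ∘ ∈-∖⁻ (c k) (Z k))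
      (C.⊆-list k k≤N ∘ proj₁ ∘ ∈-∖⁻ (c k) (Z k))
      (⊆-here k)

    outside-next-≤ : ∀ k → k < N →
      length (c k ∖ Z k) + length (c (suc k) ∩ Z (suc k)) + z k ≤ s k
    outside-next-≤ k k<N = length-disjoint₃-≤
      (∖-unique (Z k) (C.unique k k≤N)) (∩-unique (Z (suc k)) (C.unique (suc k) k<N)) (unique k)
      (λ x∈ x∈′ → C.disjoint k k<N (proj₁ (∈-∖⁻ (c k) (Z k) x∈))
                                     (proj₁ (∈-∩⁻ (c (suc k)) (Z (suc k)) x∈′)))
      (proj₂ ∘ ∈-∖⁻ (c k) (Z k))
      (λ x∈ x∈′ → disjoint k x∈′ (proj₂ (∈-∩⁻ (c (suc k)) (Z (suc k)) x∈)))
      (C.⊆-list k k≤N ∘ proj₁ ∘ ∈-∖⁻ (c k) (Z k))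
      (⊆-pred k ∘ proj₂ ∘ ∈-∩⁻ (c (suc k)) (Z (suc k)))
      (⊆-here k)
      where k≤N = <⇒≤ k<N

    demand-≤-shared : ∀ f k → k + f ≡ N → demand w s z (suc f) k ≤ length (c k ∩ Z k)
    demand-≤-shared f k k+f≡N = m≤n+o⇒m∸n≤o _ (s k ∸ z k) (begin
      w k + d                         ≡⟨ cong (_+ d) (sym split-w) ⟩
      A + B + d                       ≡⟨ +-assoc A B d ⟩
      A + (B + d)                     ≤⟨ +-monoʳ-≤ A (m+n≤o⇒m≤o∸n (B + d) (outside+demand-≤ k+f≡N)) ⟩
      A + (s k ∸ z k)                 ≡⟨ +-comm A _ ⟩
      (s k ∸ z k) + A                 ∎)
      where
      open ≤-Reasoning
      A = length (c k ∩ Z k)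
      B = length (c k ∖ Z k)
      d = demand w s z f (suc k)
      split-w : A + B ≡ w k
      split-w = trans (length-∩+∖ (c k) (Z k)) (C.length-≡ k (subst (k ≤_) k+f≡N (m≤m+n k f)))
      outside+demand-≤ : ∀ {f} → k + f ≡ N → B + demand w s z f (suc k) + z k ≤ s k
      outside+demand-≤ {zero}  k+0≡N = subst (λ b → b + z k ≤ s k) (sym (+-identityʳ B))
        (outside-≤ k (subst (k ≤_) k+0≡N (m≤m+n k 0)))
      outside+demand-≤ {suc f} k+f≡N = ≤-trans
        (+-monoˡ-≤ (z k) (+-monoʳ-≤ B (demand-≤-shared f (suc k) (+-suc-≡ k+f≡N))))
        (outside-next-≤ k (subst (suc k ≤_) (+-suc-≡ k+f≡N) (m≤m+n (suc k) f)))

  necessity : PathColorable N L w → Feasible N w s z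
  necessity (c , coloring) =
    subst (_≤ s N) (C.length-≡ N ≤-refl)
      (Unique⇒length-≤ (C.unique N ≤-refl) (C.⊆-list N ≤-refl)) ,
    n≤0⇒n≡0 (≤-trans (demand-≤-shared coloring N 0 refl)
      (subst (length (c 0 ∩ Z 0) ≤_) (cong length empty) (length-∩-≤ (Z 0) (C.unique 0 z≤n))))
    where module C = IsPathColoring coloring

  module _ (L-unique : ∀ k → Unique (L k)) (good : PathGood N w L) where

    greedy available : ℕ → ℕ → List ℕ
    greedy zero    k = []
    greedy (suc f) k = takeAvoiding (w k) (Z k) (available f k)
    available f k = L k ∖ greedy f (suc k)

    greedy-⊆ : ∀ f k → greedy f k ⊆ L k
    greedy-⊆ (suc f) k = proj₁ ∘ ∈-∖⁻ (L k) _ ∘ takeAvoiding-⊆ (w k) (Z k) (available f k)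

    greedy-unique : ∀ f k → Unique (greedy f k)
    greedy-unique zero    k = Unique.[]
    greedy-unique (suc f) k =
      takeAvoiding-unique (w k) (Z k) (available f k) (∖-unique _ (L-unique k))

    greedy-disjoint : ∀ f k → Disjoint (greedy (suc f) k) (greedy f (suc k))
    greedy-disjoint f k =
      proj₂ ∘ ∈-∖⁻ (L k) (greedy f (suc k)) ∘ takeAvoiding-⊆ (w k) (Z k) (available f k)

    L-⊆-available++shared : ∀ f k →
      L k ⊆ available f k ∖ Z k ++ Z k ++ greedy f (suc k) ∩ Z (suc k)
    L-⊆-available++shared f k {x} x∈L with x ∈? Z k | x ∈? greedy f (suc k)
    ... | yes x∈Z | _       = ∈-++⁺ʳ (available f k ∖ Z k) (∈-++⁺ˡ x∈Z)
    ... | no  x∉Z | no  x∉g = ∈-++⁺ˡ (∈-∖⁺ (∈-∖⁺ x∈L x∉g) x∉Z)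
    ... | no  x∉Z | yes x∈g =
      [ (λ x∈Z → contradiction x∈Z x∉Z)
      , (λ x∈Z′ → ∈-++⁺ʳ (available f k ∖ Z k) (∈-++⁺ʳ (Z k) (∈-∩⁺ x∈g x∈Z′)))
      ]′ (covers k x∈L (greedy-⊆ f (suc k) x∈g))

    greedy-shared : ∀ f k → length (greedy f k ∩ Z k) ≤ demand w s z f k
    available-outside-≥ : ∀ f k →
      s k ∸ z k ≤ length (available f k ∖ Z k) + demand w s z f (suc k)

    greedy-shared zero    k = z≤n
    greedy-shared (suc f) k = begin
      length (greedy (suc f) k ∩ Z k) ≤⟨ length-takeAvoiding-∩ (w k) (Z k) (available f k) ⟩
      w k ∸ O                         ≡⟨ sym ([m+n]∸[m+o]≡n∸o M (w k) O) ⟩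
      (M + w k) ∸ (M + O)             ≡⟨ cong₂ _∸_ (+-comm M (w k)) (+-comm M O) ⟩
      (w k + M) ∸ (O + M)             ≤⟨ ∸-monoʳ-≤ (w k + M) (available-outside-≥ f k) ⟩
      (w k + M) ∸ (s k ∸ z k)         ∎
      where
      open ≤-Reasoning
      O = length (available f k ∖ Z k)
      M = demand w s z f (suc k)

    available-outside-≥ f k = m≤n+o⇒m∸n≤o (s k) (z k) (begin
      s k                    ≤⟨ Unique⇒length-≤ (L-unique k) (L-⊆-available++shared f k) ⟩
      length (F ++ Z k ++ G) ≡⟨ trans (length-++ F) (cong (O +_) (length-++ (Z k))) ⟩
      O + (z k + C)          ≡⟨ sym (+-assoc O (z k) C) ⟩
      O + z k + C            ≡⟨ cong (_+ C) (+-comm O (z k)) ⟩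
      z k + O + C            ≡⟨ +-assoc (z k) O C ⟩
      z k + (O + C)          ≤⟨ +-monoʳ-≤ (z k) (+-monoʳ-≤ O (greedy-shared f (suc k))) ⟩
      z k + (O + demand w s z f (suc k)) ∎)
      where
      open ≤-Reasoning
      F = available f k ∖ Z k
      G = greedy f (suc k) ∩ Z (suc k)
      O = length F
      C = length G

    weight-fits-∖ : ∀ {k} g → w k + length g ≤ s k → w k ≤ length (L k ∖ g)
    weight-fits-∖ {k} g w+g≤s = +-cancelʳ-≤ (length g) (w k) _ (begin
      w k + length g                      ≤⟨ w+g≤s ⟩
      s k                                 ≡⟨ sym (length-∩+∖ (L k) g) ⟩
      length (L k ∩ g) + length (L k ∖ g) ≤⟨ +-monoˡ-≤ _ (length-∩-≤ g (L-unique k)) ⟩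
      length g + length (L k ∖ g)         ≡⟨ +-comm (length g) _ ⟩
      length (L k ∖ g) + length g         ∎)
      where open ≤-Reasoning

    weight-fits-of-demand≡0 : ∀ f k → demand w s z (suc f) k ≡ 0 → w k ≤ length (available f k)
    weight-fits-of-demand≡0 f k demand≡0 = ≤-trans
      (+-cancelʳ-≤ (demand w s z f (suc k)) (w k) (length (available f k ∖ Z k))
        (≤-trans (m∸n≡0⇒m≤n demand≡0) (available-outside-≥ f k)))
      (length-filter _ (available f k))

    greedy-length : w N ≤ s N → ∀ f k → k + f ≡ N → 1 ≤ k → length (greedy (suc f) k) ≡ w k
    greedy-length w≤s f k k+f≡N 1≤k =
      length-takeAvoiding (w k) (Z k) (available f k)
        (weight-fits-∖ (greedy f (suc k)) (fits f k+f≡N))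
      where
      fits : ∀ f → k + f ≡ N → w k + length (greedy f (suc k)) ≤ s k
      fits zero    k+0≡N = subst (λ i → w i + 0 ≤ s i) (sym (trans (sym (+-identityʳ k)) k+0≡N))
                             (subst (_≤ s N) (sym (+-identityʳ (w N))) w≤s)
      fits (suc f) k+f≡N = subst (λ l → w k + l ≤ s k)
                             (sym (greedy-length w≤s f (suc k) (+-suc-≡ k+f≡N) (s≤s z≤n)))
                             (good k 1≤k (subst (suc k ≤_) (+-suc-≡ k+f≡N) (m≤m+n (suc k) f)))

    sufficiency : Feasible N w s z → PathColorable N L w
    sufficiency (w≤s , demand≡0) = c , record
      { unique   = λ k _ → greedy-unique (suc (N ∸ k)) k
      ; ⊆-list   = λ k _ → greedy-⊆ (suc (N ∸ k)) k
      ; length-≡ = length-≡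
      ; disjoint = λ k k<N → subst (λ f → Disjoint (c k) (greedy f (suc k)))
                                   (+-∸-assoc 1 k<N) (greedy-disjoint (N ∸ k) k)
      }
      where
      c : ℕ → List ℕ
      c k = greedy (suc (N ∸ k)) k
      length-≡ : ∀ k → k ≤ N → length (c k) ≡ w k
      length-≡ zero    _   =
        length-takeAvoiding (w 0) (Z 0) (available N 0) (weight-fits-of-demand≡0 N 0 demand≡0)
      length-≡ (suc k) k<N = greedy-length w≤s (N ∸ suc k) (suc k) (m+[n∸m]≡n k<N) (s≤s z≤n)

  colorable⇔feasible : (∀ k → Unique (L k)) → PathGood N w L →
    PathColorable N L w ⇔ Feasible N w s z
  colorable⇔feasible L-unique good = mk⇔ necessity (sufficiency L-unique good)

module _ (L : ℕ → List ℕ) where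

  charged : ℕ → List ℕ
  charged zero    = []
  charged (suc k) = L (suc k) ∩ (L k ∖ charged k)

  module _ (L-unique : ∀ k → Unique (L k)) where

    charged-splitting : EdgeSplitting L charged
    charged-splitting = record
      { unique   = unique
      ; ⊆-here   = ⊆-here
      ; ⊆-pred   = ⊆-pred
      ; disjoint = λ k x∈ x∈′ → proj₂ (∈-∖⁻ (L k) (charged k) (proj₂ (∈-∩⁻ (L (suc k)) _ x∈′)))
                                      x∈
      ; covers   = covers
      ; empty    = refl
      }
      where
      unique : ∀ k → Unique (charged k)
      unique zero    = Unique.[]
      unique (suc k) = ∩-unique _ (L-unique (suc k))
      ⊆-here : ∀ k → charged k ⊆ L k
      ⊆-here (suc k) = proj₁ ∘ ∈-∩⁻ (L (suc k)) _
      ⊆-pred : ∀ k → charged (suc k) ⊆ L k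
      ⊆-pred k = proj₁ ∘ ∈-∖⁻ (L k) (charged k) ∘ proj₂ ∘ ∈-∩⁻ (L (suc k)) _
      covers : ∀ k {x} → x ∈ L k → x ∈ L (suc k) → x ∈ charged k ⊎ x ∈ charged (suc k)
      covers k {x} x∈L x∈L′ with x ∈? charged k
      ... | yes x∈Z = inj₁ x∈Z
      ... | no  x∉Z = inj₂ (∈-∩⁺ x∈L′ (∈-∖⁺ x∈L x∉Z))

module Intervals (s z : ℕ → ℕ) (z₀ : z 0 ≡ 0) (fits : ∀ k → z k + z (suc k) ≤ s k) where

  left : ℕ → ℕ
  left zero    = 0
  left (suc k) = left k + (s k ∸ z (suc k))

  lists shared : ℕ → List ℕ
  lists  k = interval (left k) (s k)
  shared k = interval (left k) (z k)

  z′≤s : ∀ k → z (suc k) ≤ s k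
  z′≤s k = m+n≤o⇒n≤o (z k) (fits k)

  left-suc+z : ∀ k → left (suc k) + z (suc k) ≡ left k + s k
  left-suc+z k = trans (+-assoc (left k) _ _) (cong (left k +_) (m∸n+n≡m (z′≤s k)))

  left-mono : ∀ j d → left j ≤ left (d + j)
  left-mono j zero    = ≤-refl
  left-mono j (suc d) = ≤-trans (left-mono j d) (m≤m+n _ _)

  end≤left-suc-suc : ∀ k → left k + s k ≤ left (suc (suc k))
  end≤left-suc-suc k = subst (_≤ left (suc (suc k))) (left-suc+z k)
    (+-monoʳ-≤ (left (suc k)) (m+n≤o⇒m≤o∸n (z (suc k)) (fits (suc k))))

  splitting : EdgeSplitting lists shared
  splitting = record
    { unique   = λ k → interval-unique (left k) (z k)
    ; ⊆-here   = λ k → interval-⊆ ≤-refl (+-monoʳ-≤ (left k) (m+n≤o⇒m≤o (z k) (fits k)))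
    ; ⊆-pred   = λ k → interval-⊆ (m≤m+n _ _) (≤-reflexive (left-suc+z k))
    ; disjoint = λ k → interval-disjoint (+-monoʳ-≤ (left k) (m+n≤o⇒m≤o∸n (z k) (fits k)))
    ; covers   = λ k {x} x∈ x∈′ → inj₂ (∈-interval⁺ (proj₁ (∈-interval⁻ x∈′))
                                      (subst (x <_) (sym (left-suc+z k)) (proj₂ (∈-interval⁻ x∈))))
    ; empty    = cong (interval 0) z₀
    }

  waterfall : ∀ j k → j + 2 ≤ k → Disjoint (lists j) (lists k)
  waterfall j k j+2≤k = interval-disjoint (begin
    left j + s j       ≤⟨ end≤left-suc-suc j ⟩
    left (2 + j)       ≤⟨ left-mono (2 + j) (k ∸ (2 + j)) ⟩
    left (k ∸ (2 + j) + (2 + j)) ≡⟨ cong left (m∸n+n≡m (subst (_≤ k) (+-comm j 2) j+2≤k)) ⟩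
    left k             ∎)
    where open ≤-Reasoning

  lists-unique : ∀ k → Unique (lists k)
  lists-unique k = interval-unique (left k) (s k)

  length-lists : ∀ k → length (lists k) ≡ s k
  length-lists k = length-interval (left k) (s k)

  length-shared : ∀ k → length (shared k) ≡ z k
  length-shared k = length-interval (left k) (z k)

clamp : (n : ℕ) → ℕ → Fin (suc n)
clamp n k = fromℕ< (s≤s (m⊓n≤n k n))

toℕ-clamp : ∀ {n k} → k ≤ n → toℕ (clamp n k) ≡ k
toℕ-clamp k≤n = trans (Fin.toℕ-fromℕ< _) (m≤n⇒m⊓n≡m k≤n)

clamp-toℕ : ∀ {n} (i : Fin (suc n)) → clamp n (toℕ i) ≡ i
clamp-toℕ i = Fin.toℕ-injective (toℕ-clamp (Fin.toℕ≤pred[n] i))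

Edge-clamp : ∀ {n k} → k < n → Edge (clamp n k) (clamp n (suc k))
Edge-clamp k<n = trans (toℕ-clamp k<n) (cong suc (sym (toℕ-clamp (<⇒≤ k<n))))

module _ {n : ℕ} (w : Weight n) {L : ListAssignment n} {L⁺ : ℕ → List ℕ}
         (L≡ : ∀ i → L i ≡ L⁺ (toℕ i)) where

  colorable⇔pathColorable : Colorable L w ⇔ PathColorable n L⁺ (w ∘ clamp n)
  colorable⇔pathColorable = mk⇔ to from
    where
    to : Colorable L w → PathColorable n L⁺ (w ∘ clamp n)
    to (c , c-unique , c⊆L , c-length , c-disjoint) = c ∘ clamp n , record
      { unique   = λ k _ → c-unique (clamp n k)
      ; ⊆-list   = λ k k≤n → subst (c (clamp n k) ⊆_) (trans (L≡ _) (cong L⁺ (toℕ-clamp k≤n)))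
                                     (c⊆L (clamp n k))
      ; length-≡ = λ k _ → c-length (clamp n k)
      ; disjoint = λ k k<n → c-disjoint (clamp n k) (clamp n (suc k)) (Edge-clamp k<n)
      }
    from : PathColorable n L⁺ (w ∘ clamp n) → Colorable L w
    from (c , coloring) =
      c ∘ toℕ ,
      (λ i → C.unique (toℕ i) (toℕ≤n i)) ,
      (λ i → subst (c (toℕ i) ⊆_) (sym (L≡ i)) (C.⊆-list (toℕ i) (toℕ≤n i))) ,
      (λ i → trans (C.length-≡ (toℕ i) (toℕ≤n i)) (cong w (clamp-toℕ i))) ,
      (λ i j j≡1+i → subst (λ m → Disjoint (c (toℕ i)) (c m)) (sym j≡1+i)
                       (C.disjoint (toℕ i) (subst (_≤ n) j≡1+i (toℕ≤n j))))
      where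
      module C = IsPathColoring coloring
      toℕ≤n : (i : Fin (suc n)) → toℕ i ≤ n
      toℕ≤n = Fin.toℕ≤pred[n]

module WaterfallConstruction (n : ℕ) (w : Weight n) (L : ListAssignment n)
  (L-unique : IsListAssignment L) (good : Good w L) where

  w⁺ : ℕ → ℕ
  w⁺ = w ∘ clamp n

  L⁺ : ℕ → List ℕ
  L⁺ = L ∘ clamp n

  split : EdgeSplitting L⁺ (charged L⁺)
  split = charged-splitting L⁺ (L-unique ∘ clamp n)

  open Intervals (length ∘ L⁺) (length ∘ charged L⁺) refl (EdgeSplitting-fits split)

  Lc : ListAssignment n
  Lc i = lists (toℕ i)

  good⁺ : PathGood n w⁺ L⁺
  good⁺ k 1≤k k<n = good (clamp n k) (clamp n (suc k))
    (subst (1 ≤_) (sym (toℕ-clamp (<⇒≤ k<n))) 1≤k)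
    (subst (λ m → suc m < suc n) (sym (toℕ-clamp (<⇒≤ k<n))) (s≤s k<n))
    (Edge-clamp k<n)

  goodc : PathGood n w⁺ lists
  goodc k 1≤k k<n = subst (w⁺ k + w⁺ (suc k) ≤_) (sym (length-lists k)) (good⁺ k 1≤k k<n)

  similar : Similar w L Lc
  similar =
    ⇔.trans (colorable⇔pathColorable w (λ i → cong L (sym (clamp-toℕ i))))
    (⇔.trans (Characterisation.colorable⇔feasible split n w⁺ (L-unique ∘ clamp n) good⁺)
    (⇔.trans (mk⇔ (Feasible-resp (sym ∘ length-lists) (sym ∘ length-shared))
                  (Feasible-resp length-lists length-shared))
    (⇔.trans (⇔.sym (Characterisation.colorable⇔feasible splitting n w⁺ lists-unique goodc))
             (⇔.sym (colorable⇔pathColorable w (λ i → refl))))))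

  Lc-unique : IsListAssignment Lc
  Lc-unique = lists-unique ∘ toℕ

  Lc-waterfall : Waterfall Lc
  Lc-waterfall i j (inj₁ i+2≤j) = waterfall (toℕ i) (toℕ j) i+2≤j
  Lc-waterfall i j (inj₂ j+2≤i) x∈i x∈j = waterfall (toℕ j) (toℕ i) j+2≤i x∈j x∈i

  length-Lc : ∀ i → length (Lc i) ≡ length (L i)
  length-Lc i = trans (length-lists (toℕ i)) (cong (length ∘ L) (clamp-toℕ i))

proposition1 : (n : ℕ) (w : Weight n) (L : ListAssignment n) →
    IsListAssignment L → Good w L →
    Σ (ListAssignment n) λ Lc →
      IsListAssignment Lc × Waterfall Lc × Similar w L Lc ×
      (∀ i → length (Lc i) ≡ length (L i))
proposition1 n w L L-unique good =
  Lc , Lc-unique , Lc-waterfall , similar , length-Lc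
  where open WaterfallConstruction n w L L-unique good
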